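{- Let $\mathbf{f}\in\mathbb{Q}[[t]]$ satisfy $\mathbf{f}=\sum_{0\le n\le d}P_n\mathbf{f}^n$ for some integer $d\ge0$ and polynomials $P_n\in\mathbb{Q}[t]$ with all coefficients in $\mathbb{N}$, such that $\langle t^0,P_1\rangle=0$, $\langle t^0,P_0\rangle=0$ and $\langle t^1,P_0\rangle=1$. Let $\mathfrak{G}=\bigsqcup_{n\ge2}\mathfrak{G}(n)$ with $\mathfrak{G}(n):=\bigsqcup_{k,\ell\ge0,\,k+\ell=n}\{\mathtt{a}^{(m)}_{k,\ell}:1\le m\le\langle t^\ell,P_k\rangle\}$, and let \[ \mathcal{P}:=\bigsqcup_{\mathtt{a}^{(m)}_{k,\ell}\in\mathfrak{G},\ i\in[\ell]}\{\mathtt{a}^{(m)}_{k,\ell}\circ_i\mathtt{b}:\mathtt{b}\in\mathfrak{G}\}. \] Then the specialization of $F(\mathcal{P},\emptyset)$ at $q:=1$ and $q_\mathtt{a}:=1$ for all $\mathtt{a}\in\mathfrak{G}$ satisfies the same algebraic equation as $\mathbf{f}$, namely $X=\sum_{0\le n\le d}P_nX^n$.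
   Context: $\langle t^j,P\rangle$ denotes the coefficient of $t^j$ in $P$. An alphabet is a graded set; a $\mathfrak{G}$-tree is a planar rooted tree whose internal nodes of arity $k$ are labeled by letters of arity $k$; $|\mathfrak{t}|$ = number of leaves, $\deg(\mathfrak{t})$ = number of internal nodes, $\deg_\mathtt{a}(\mathfrak{t})$ = number labeled $\mathtt{a}$. $\mathtt{a}\circ_i\mathtt{b}$ denotes the tree obtained by grafting the corolla $\mathtt{b}$ (one internal node labeled $\mathtt{b}$) onto the $i$th leaf of the corolla $\mathtt{a}$. $\mathfrak{s}$ is a factor of $\mathfrak{t}$ if a copy of $\mathfrak{s}$ occurs in $\mathfrak{t}$, i.e. $\mathfrak{t}=\mathfrak{r}\circ_i(\mathfrak{s}\circ[\mathfrak{r}_1,\dots,\mathfrak{r}_{|\mathfrak{s}|}])$ for some trees (grafting on leaves). $F(\mathcal{P},\emptyset):=\sum_{\mathfrak{t}}t^{|\mathfrak{t}|}q^{\deg(\mathfrak{t})}\prod_\mathtt{a}q_\mathtt{a}^{\deg_\mathtt{a}(\mathfrak{t})}$, the sum over all $\mathfrak{G}$-trees $\mathfrak{t}$ having no factor in $\mathcal{P}$. -}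

module Defs where

open import Data.Nat using (ℕ; zero; suc; _≤_; _<_; _∸_)
import Data.Nat as ℕ
open import Data.Fin using (Fin; toℕ)
open import Data.Vec using (Vec; lookup; replicate; _[_]≔_) renaming ([] to []ᵥ; _∷_ to _∷ᵥ_)
open import Data.List using (List; []; _∷_; length)
open import Data.List.Membership.Propositional using (_∈_)
open import Data.List.Relation.Unary.Unique.Propositional using (Unique)
open import Data.Integer using (+_)
open import Data.Rational using (ℚ; _+_; _*_; _/_; 0ℚ; 1ℚ)
open import Data.Product using (Σ; _×_; _,_)
open import Relation.Binary.PropositionalEquality using (_≡_)
open import Relation.Nullary using (¬_)
open import Function.Bundles using (_⇔_)

-- Polynomials with coefficients in ℕ, as coefficient lists
-- (entry j = coefficient of t^j).  ⟨t^j , p⟩ = coeff p j.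

coeff : List ℕ → ℕ → ℕ
coeff []       _       = 0
coeff (c ∷ cs) zero    = c
coeff (c ∷ cs) (suc j) = coeff cs j

toℚ : ℕ → ℚ
toℚ n = (+ n) / 1

Series : Set
Series = ℕ → ℚ

Σ≤ : ℕ → (ℕ → ℚ) → ℚ
Σ≤ zero    g = g 0
Σ≤ (suc n) g = Σ≤ n g + g (suc n)

polyS : List ℕ → Series
polyS p j = toℚ (coeff p j)

oneS : Series
oneS zero    = 1ℚ
oneS (suc _) = 0ℚ

_*S_ : Series → Series → Series
(f *S g) n = Σ≤ n (λ i → f i * g (n ∸ i))

_^S_ : Series → ℕ → Series
f ^S zero  = oneS
f ^S suc n = f *S (f ^S n)

SatisfiesEq : (d : ℕ) → (P : ℕ → List ℕ) → Series → Set
SatisfiesEq d P X = ∀ j → X j ≡ Σ≤ d (λ n → (polyS (P n) *S (X ^S n)) j)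

-- The alphabet 𝔊: letters a^{(m)}_{k,ℓ} with k ≤ d (P_k = 0 for k > d),
-- k + ℓ ≥ 2, and 1 ≤ m ≤ ⟨t^ℓ, P_k⟩ (m encoded as Fin ⟨t^ℓ,P_k⟩).

record Letter (d : ℕ) (P : ℕ → List ℕ) : Set where
  constructor letter
  field
    k   : ℕ
    ℓ   : ℕ
    k≤d : k ≤ d
    2≤  : 2 ≤ k ℕ.+ ℓ
    m   : Fin (coeff (P k) ℓ)

arity : ∀ {d P} → Letter d P → ℕ
arity a = Letter.k a ℕ.+ Letter.ℓ a

-- Planar rooted 𝔊-trees; children of a node are ordered by Fin (arity a).
data Tree (d : ℕ) (P : ℕ → List ℕ) : Set where
  leaf : Tree d P
  node : (a : Letter d P) → Vec (Tree d P) (arity a) → Tree d P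

mutual
  leaves : ∀ {d P} → Tree d P → ℕ
  leaves leaf        = 1
  leaves (node a ts) = leavesV ts

  leavesV : ∀ {d P n} → Vec (Tree d P) n → ℕ
  leavesV []ᵥ        = 0
  leavesV (t ∷ᵥ ts)  = leaves t ℕ.+ leavesV ts

-- Factors.  Match s t : a copy of s occurs at the root of t, i.e.
-- t = s ∘ [r_1, …, r_|s|] (leaves of s may be replaced by any trees).

data Match {d P} : Tree d P → Tree d P → Set where
  leaf-match : ∀ {t} → Match leaf t
  node-match : ∀ {a ss ts} → (∀ i → Match (lookup ss i) (lookup ts i)) →
               Match (node a ss) (node a ts)

-- Factor s t : t = r ∘_i (s ∘ [r_1, …, r_|s|]) for some trees.
data Factor {d P} (s : Tree d P) : Tree d P → Set where
  here  : ∀ {t} → Match s t → Factor s t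
  there : ∀ {a ts} (i : Fin (arity a)) → Factor s (lookup ts i) → Factor s (node a ts)

corolla : ∀ {d P} → Letter d P → Tree d P
corolla a = node a (replicate (arity a) leaf)

graft : ∀ {d P} (a : Letter d P) → Fin (arity a) → Letter d P → Tree d P
graft a i b = node a (replicate (arity a) leaf [ i ]≔ corolla b)

-- i ∈ [ℓ] = {1,…,ℓ}: the first ℓ leaf positions (toℕ i < ℓ, 0-based)
InPattern : ∀ {d P} → Tree d P → Set
InPattern {d} {P} s =
  Σ (Letter d P) λ a → Σ (Letter d P) λ b → Σ (Fin (arity a)) λ i →
    toℕ i < Letter.ℓ a × s ≡ graft a i b

Avoids : ∀ {d P} → Tree d P → Set
Avoids {d} {P} t = ∀ (s : Tree d P) → InPattern s → ¬ Factor s t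

-- ts is a duplicate-free list of exactly the trees with j leaves and
-- no factor in 𝒫 (so length ts is the coefficient of t^j in F(𝒫,∅)|_{q=1,q_a=1}).
Enumerates : ∀ d P → ℕ → List (Tree d P) → Set
Enumerates d P j ts =
  Unique ts × (∀ (t : Tree d P) → (t ∈ ts) ⇔ (leaves t ≡ j × Avoids t))

module Submission where

-- A pattern a ∘_i b of 𝒫 occurs in a tree exactly when some node labelled
-- a = a^{(m)}_{k,ℓ} has a non-leaf among its first ℓ children.  So a tree
-- avoids 𝒫 iff it is "admissible": at every node a^{(m)}_{k,ℓ} the first ℓ
-- children are leaves (the remaining k children being arbitrary admissible
-- trees).  Admissible trees are built freely, and counting them by leaves,
-- c_j satisfies
--   c_j = [j = 1] + Σ_{k ≤ d} Σ_{ℓ ≤ j, k+ℓ ≥ 2} ⟨t^ℓ,P_k⟩ · (c^k)_{j-ℓ} .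
-- The hypotheses ⟨t^0,P_0⟩ = ⟨t^0,P_1⟩ = 0 and ⟨t^1,P_0⟩ = 1 say that the
-- excluded pairs k+ℓ < 2 contribute exactly the leaf term [j = 1], so this is
-- the coefficient of t^j in Σ_k P_k c^k.

open import Defs
open import Data.Nat as ℕ using (ℕ; zero; suc; _≤_; _<_; z≤n; s≤s; _∸_; _≤?_)
import Data.Nat.Properties as ℕP
open import Algebra.Properties.CommutativeSemigroup ℕP.+-commutativeSemigroup using (interchange)
open import Data.Nat.Coprimality using (1-coprimeTo) renaming (sym to coprime-sym)
open import Data.Integer as ℤ using (+_)
import Data.Integer.Properties as ℤP
open import Data.Rational as ℚ using (ℚ; mkℚ)
import Data.Rational.Properties as ℚP
open import Data.Fin as Fin using (Fin; toℕ)
open import Data.Vec as Vec using (Vec; lookup; replicate; _[_]≔_) renaming ([] to []ᵥ; _∷_ to _∷ᵥ_)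
open import Data.Vec.Properties using (lookup∘update; lookup∘update′; lookup-replicate)
open import Data.List using (List; []; _∷_; _++_; map; length; allFin; concatMap)
open import Data.List.Properties using (length-++; length-map; length-tabulate)
open import Data.List.Membership.Propositional using (_∈_; find; lose)
open import Data.List.Membership.Propositional.Properties
  using (∈-++⁺ˡ; ∈-++⁺ʳ; ∈-++⁻; ∈-map⁺; ∈-map⁻; ∈-allFin; ∈-concatMap⁺; ∈-concatMap⁻)
open import Data.List.Membership.Propositional.Properties.WithK using (unique∧set⇒bag)
open import Data.List.Relation.Binary.BagAndSetEquality using (∼bag⇒↭)
open import Data.List.Relation.Binary.Permutation.Propositional.Properties using (↭-length)
open import Data.List.Relation.Unary.Any using (here; there)
import Data.List.Relation.Unary.All as All
open import Data.List.Relation.Unary.AllPairs using ([]; _∷_)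
open import Data.List.Relation.Unary.Unique.Propositional using (Unique)
import Data.List.Relation.Unary.Unique.Propositional.Properties as Unique
open import Data.Product using (Σ; _×_; _,_; proj₁; proj₂; ∃)
open import Data.Sum using (inj₁; inj₂)
open import Data.Unit using (⊤; tt)
open import Data.Empty using (⊥; ⊥-elim)
open import Relation.Nullary using (¬_; Dec; yes; no)
open import Relation.Binary.PropositionalEquality
open import Function.Bundles using (_⇔_; mk⇔)

Σℕ≤ : ℕ → (ℕ → ℕ) → ℕ
Σℕ≤ zero    g = g 0
Σℕ≤ (suc n) g = Σℕ≤ n g ℕ.+ g (suc n)

Σℕ≤-cong : ∀ n {f g : ℕ → ℕ} → (∀ i → i ≤ n → f i ≡ g i) → Σℕ≤ n f ≡ Σℕ≤ n g
Σℕ≤-cong zero    e = e 0 z≤n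
Σℕ≤-cong (suc n) e =
  cong₂ ℕ._+_ (Σℕ≤-cong n (λ i i≤n → e i (ℕP.m≤n⇒m≤1+n i≤n))) (e (suc n) ℕP.≤-refl)

Σℕ≤-+ : ∀ n (f g : ℕ → ℕ) → Σℕ≤ n (λ i → f i ℕ.+ g i) ≡ Σℕ≤ n f ℕ.+ Σℕ≤ n g
Σℕ≤-+ zero    f g = refl
Σℕ≤-+ (suc n) f g =
  trans (cong (ℕ._+ (f (suc n) ℕ.+ g (suc n))) (Σℕ≤-+ n f g))
        (interchange (Σℕ≤ n f) (Σℕ≤ n g) (f (suc n)) (g (suc n)))

Σℕ≤-vanish : ∀ n (g : ℕ → ℕ) → (∀ i → i ≤ n → g i ≡ 0) → Σℕ≤ n g ≡ 0
Σℕ≤-vanish zero    g h = h 0 z≤n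
Σℕ≤-vanish (suc n) g h =
  cong₂ ℕ._+_ (Σℕ≤-vanish n g (λ i i≤n → h i (ℕP.m≤n⇒m≤1+n i≤n))) (h (suc n) ℕP.≤-refl)

Σℕ≤-single : ∀ n i (g : ℕ → ℕ) → i ≤ n → (∀ k → k ≢ i → g k ≡ 0) → Σℕ≤ n g ≡ g i
Σℕ≤-single zero .zero g z≤n h = refl
Σℕ≤-single (suc n) i g i≤1+n h with ℕP.m≤n⇒m<n∨m≡n i≤1+n
... | inj₁ (s≤s i≤n) =
  trans (cong (Σℕ≤ n g ℕ.+_) (h (suc n) λ { refl → ℕP.<-irrefl refl (s≤s i≤n) }))
        (trans (ℕP.+-identityʳ _) (Σℕ≤-single n i g i≤n h))
... | inj₂ refl =
  cong (ℕ._+ g (suc n)) (Σℕ≤-vanish n g λ k k≤n → h k λ { refl → ℕP.<-irrefl refl (s≤s k≤n) })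

unique-same-length : ∀ {A : Set} {xs ys : List A} → Unique xs → Unique ys →
                     (∀ {x} → x ∈ xs ⇔ x ∈ ys) → length xs ≡ length ys
unique-same-length ux uy same = ↭-length (∼bag⇒↭ (unique∧set⇒bag ux uy same))

module _ {A : Set} where

  cat≤ : ℕ → (ℕ → List A) → List A
  cat≤ zero    g = g 0
  cat≤ (suc n) g = cat≤ n g ++ g (suc n)

  ∈-cat≤⁻ : ∀ n g {x} → x ∈ cat≤ n g → ∃ λ i → i ≤ n × x ∈ g i
  ∈-cat≤⁻ zero    g x∈ = 0 , z≤n , x∈
  ∈-cat≤⁻ (suc n) g x∈ with ∈-++⁻ (cat≤ n g) x∈
  ... | inj₁ x∈init = let i , i≤n , x∈gi = ∈-cat≤⁻ n g x∈init in i , ℕP.m≤n⇒m≤1+n i≤n , x∈gi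
  ... | inj₂ x∈last = suc n , ℕP.≤-refl , x∈last

  ∈-cat≤⁺ : ∀ n g {i x} → i ≤ n → x ∈ g i → x ∈ cat≤ n g
  ∈-cat≤⁺ zero    g z≤n x∈ = x∈
  ∈-cat≤⁺ (suc n) g i≤1+n x∈ with ℕP.m≤n⇒m<n∨m≡n i≤1+n
  ... | inj₁ (s≤s i≤n) = ∈-++⁺ˡ (∈-cat≤⁺ n g i≤n x∈)
  ... | inj₂ refl      = ∈-++⁺ʳ (cat≤ n g) x∈

  length-cat≤ : ∀ n g → length (cat≤ n g) ≡ Σℕ≤ n (λ i → length (g i))
  length-cat≤ zero    g = refl
  length-cat≤ (suc n) g =
    trans (length-++ (cat≤ n g)) (cong (ℕ._+ length (g (suc n))) (length-cat≤ n g))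

  -- If every entry of g i has key i, the blocks are disjoint, so cat≤ of
  -- duplicate-free blocks is duplicate-free.
  unique-cat≤ : ∀ n g (key : A → ℕ) → (∀ i {x} → x ∈ g i → key x ≡ i) →
                (∀ i → Unique (g i)) → Unique (cat≤ n g)
  unique-cat≤ zero    g key keyed u = u 0
  unique-cat≤ (suc n) g key keyed u = Unique.++⁺ (unique-cat≤ n g key keyed u) (u (suc n)) disjoint
    where
    disjoint : ∀ {x} → x ∈ cat≤ n g × x ∈ g (suc n) → ⊥
    disjoint (x∈init , x∈last) =
      let i , i≤n , x∈gi = ∈-cat≤⁻ n g x∈init
      in ℕP.<-irrefl refl (subst (_≤ n) (trans (sym (keyed i x∈gi)) (keyed (suc n) x∈last)) i≤n)

module _ {A B : Set} (f : A → List B) where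

  ∈-concatMap⁻′ : ∀ xs {y} → y ∈ concatMap f xs → ∃ λ x → x ∈ xs × y ∈ f x
  ∈-concatMap⁻′ xs y∈ = find (∈-concatMap⁻ f {xs = xs} y∈)

  ∈-concatMap⁺′ : ∀ {xs x y} → x ∈ xs → y ∈ f x → y ∈ concatMap f xs
  ∈-concatMap⁺′ x∈ y∈ = ∈-concatMap⁺ f (lose x∈ y∈)

  -- If each y ∈ f x determines x (through a functional relation R), the
  -- blocks f x are disjoint and concatMap preserves duplicate-freeness.
  unique-concatMap : (R : A → B → Set) → (∀ x {y} → y ∈ f x → R x y) →
                     (∀ {x x′ y} → R x y → R x′ y → x ≡ x′) →
                     (∀ x → Unique (f x)) → ∀ {xs} → Unique xs → Unique (concatMap f xs)
  unique-concatMap R related functional u []                   = []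
  unique-concatMap R related functional u {x ∷ xs} (x∉ ∷ uxs) =
    Unique.++⁺ (u x) (unique-concatMap R related functional u uxs) disjoint
    where
    disjoint : ∀ {y} → y ∈ f x × y ∈ concatMap f xs → ⊥
    disjoint (y∈fx , y∈rest) =
      let z , z∈xs , y∈fz = ∈-concatMap⁻′ xs y∈rest
      in All.lookup x∉ z∈xs (functional (related x y∈fx) (related z y∈fz))

  length-concatMap-const : ∀ c xs → (∀ {x} → x ∈ xs → length (f x) ≡ c) →
                           length (concatMap f xs) ≡ length xs ℕ.* c
  length-concatMap-const c []       const = refl
  length-concatMap-const c (x ∷ xs) const =
    trans (length-++ (f x))
          (cong₂ ℕ._+_ (const (here refl)) (length-concatMap-const c xs (λ x∈ → const (there x∈))))

δ₀ : ℕ → ℕ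
δ₀ zero    = 1
δ₀ (suc _) = 0

_⋆_ : (ℕ → ℕ) → (ℕ → ℕ) → ℕ → ℕ
(f ⋆ g) n = Σℕ≤ n (λ i → f i ℕ.* g (n ∸ i))

_^⋆_ : (ℕ → ℕ) → ℕ → ℕ → ℕ
f ^⋆ zero  = δ₀
f ^⋆ suc k = f ⋆ (f ^⋆ k)

^⋆-local : ∀ {f g : ℕ → ℕ} M → (∀ i → i ≤ M → f i ≡ g i) →
           ∀ k m → m ≤ M → (f ^⋆ k) m ≡ (g ^⋆ k) m
^⋆-local M agree zero    m m≤M = refl
^⋆-local M agree (suc k) m m≤M = Σℕ≤-cong m λ i i≤m →
  cong₂ ℕ._*_ (agree i (ℕP.≤-trans i≤m m≤M))
              (^⋆-local M agree k (m ∸ i) (ℕP.≤-trans (ℕP.m∸n≤m m i) m≤M))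

toℚ≡mkℚ : ∀ n → toℚ n ≡ mkℚ (+ n) 0 (coprime-sym (1-coprimeTo n))
toℚ≡mkℚ n = ℚP.normalize-coprime (coprime-sym (1-coprimeTo n))

toℚ-+ : ∀ a b → toℚ (a ℕ.+ b) ≡ toℚ a ℚ.+ toℚ b
toℚ-+ a b rewrite toℚ≡mkℚ a | toℚ≡mkℚ b = ℚP./-cong {p₁ = + (a ℕ.+ b)} numerators refl
  where
  numerators : + (a ℕ.+ b) ≡ (+ a ℤ.* + 1) ℤ.+ (+ b ℤ.* + 1)
  numerators = trans (ℤP.pos-+ a b)
                     (sym (cong₂ ℤ._+_ (ℤP.*-identityʳ (+ a)) (ℤP.*-identityʳ (+ b))))

toℚ-* : ∀ a b → toℚ (a ℕ.* b) ≡ toℚ a ℚ.* toℚ b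
toℚ-* a b rewrite toℚ≡mkℚ a | toℚ≡mkℚ b = ℚP./-cong {p₁ = + (a ℕ.* b)} (ℤP.pos-* a b) refl

Σ≤-cong : ∀ n {f g : ℕ → ℚ} → (∀ i → f i ≡ g i) → Σ≤ n f ≡ Σ≤ n g
Σ≤-cong zero    e = e 0
Σ≤-cong (suc n) e = cong₂ ℚ._+_ (Σ≤-cong n e) (e (suc n))

toℚ-Σ : ∀ n f → toℚ (Σℕ≤ n f) ≡ Σ≤ n (λ i → toℚ (f i))
toℚ-Σ zero    f = refl
toℚ-Σ (suc n) f = trans (toℚ-+ (Σℕ≤ n f) (f (suc n))) (cong (ℚ._+ toℚ (f (suc n))) (toℚ-Σ n f))

toℚ-^⋆ : ∀ (c : ℕ → ℕ) k m → ((λ j → toℚ (c j)) ^S k) m ≡ toℚ ((c ^⋆ k) m)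
toℚ-^⋆ c zero    zero    = refl
toℚ-^⋆ c zero    (suc m) = refl
toℚ-^⋆ c (suc k) m =
  trans (Σ≤-cong m λ i → trans (cong (toℚ (c i) ℚ.*_) (toℚ-^⋆ c k (m ∸ i)))
                               (sym (toℚ-* (c i) ((c ^⋆ k) (m ∸ i)))))
        (sym (toℚ-Σ m _))

satisfiesEq-toℚ : ∀ d P (c : ℕ → ℕ) →
  (∀ j → c j ≡ Σℕ≤ d (λ k → Σℕ≤ j λ ℓ → coeff (P k) ℓ ℕ.* (c ^⋆ k) (j ∸ ℓ))) →
  SatisfiesEq d P (λ j → toℚ (c j))
satisfiesEq-toℚ d P c rec j = begin
  toℚ (c j)                                                              ≡⟨ cong toℚ (rec j) ⟩
  toℚ (Σℕ≤ d (λ k → Σℕ≤ j λ ℓ → coeff (P k) ℓ ℕ.* (c ^⋆ k) (j ∸ ℓ)))     ≡⟨ toℚ-Σ d _ ⟩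
  Σ≤ d (λ k → toℚ (Σℕ≤ j λ ℓ → coeff (P k) ℓ ℕ.* (c ^⋆ k) (j ∸ ℓ)))      ≡⟨ Σ≤-cong d inner ⟩
  Σ≤ d (λ k → (polyS (P k) *S ((λ i → toℚ (c i)) ^S k)) j)               ∎
  where
  open ≡-Reasoning
  inner : ∀ k → toℚ (Σℕ≤ j λ ℓ → coeff (P k) ℓ ℕ.* (c ^⋆ k) (j ∸ ℓ)) ≡ (polyS (P k) *S ((λ i → toℚ (c i)) ^S k)) j
  inner k = trans (toℚ-Σ j _) (Σ≤-cong j λ ℓ →
    trans (toℚ-* (coeff (P k) ℓ) _) (cong (toℚ (coeff (P k) ℓ) ℚ.*_) (sym (toℚ-^⋆ c k (j ∸ ℓ)))))

module Trees (d : ℕ) (P : ℕ → List ℕ) where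

  Tr : Set
  Tr = Tree d P

  LeafPrefix : ∀ {n} → ℕ → Vec Tr n → Set
  LeafPrefix zero    v         = ⊤
  LeafPrefix (suc ℓ) []ᵥ       = ⊤
  LeafPrefix (suc ℓ) (x ∷ᵥ v) = x ≡ leaf × LeafPrefix ℓ v

  leafPrefix-lookup : ∀ {n ℓ} (v : Vec Tr n) → LeafPrefix ℓ v → ∀ i → toℕ i < ℓ → lookup v i ≡ leaf
  leafPrefix-lookup {ℓ = suc ℓ} (x ∷ᵥ v) (x≡leaf , _) Fin.zero    _        = x≡leaf
  leafPrefix-lookup {ℓ = suc ℓ} (x ∷ᵥ v) (_ , pre)    (Fin.suc i) (s≤s i<ℓ) = leafPrefix-lookup v pre i i<ℓ

  leafPrefix-intro : ∀ {n ℓ} (v : Vec Tr n) → (∀ i → toℕ i < ℓ → lookup v i ≡ leaf) → LeafPrefix ℓ v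
  leafPrefix-intro {ℓ = zero}  v         h = tt
  leafPrefix-intro {ℓ = suc ℓ} []ᵥ       h = tt
  leafPrefix-intro {ℓ = suc ℓ} (x ∷ᵥ v) h =
    h Fin.zero (s≤s z≤n) , leafPrefix-intro v (λ i i<ℓ → h (Fin.suc i) (s≤s i<ℓ))

  data Admissible : Tr → Set where
    adm-leaf : Admissible leaf
    adm-node : ∀ {a ts} → LeafPrefix (Letter.ℓ a) ts → (∀ i → Admissible (lookup ts i)) →
           Admissible (node a ts)

  graft-match : ∀ a (ts : Vec Tr (arity a)) i b us → lookup ts i ≡ node b us →
                Match (graft a i b) (node a ts)
  graft-match a ts i b us ts[i]≡b = node-match matchChild
    where
    corolla-match : Match (corolla b) (node b us)
    corolla-match = node-match λ k →
      subst (λ s → Match s (lookup us k)) (sym (lookup-replicate k leaf)) leaf-match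
    matchChild : ∀ j → Match (lookup (replicate (arity a) leaf [ i ]≔ corolla b) j) (lookup ts j)
    matchChild j with j Fin.≟ i
    ... | yes refl = subst₂ Match (sym (lookup∘update i (replicate _ leaf) (corolla b))) (sym ts[i]≡b)
                            corolla-match
    ... | no j≢i   = subst (λ s → Match s (lookup ts j))
                           (sym (trans (lookup∘update′ j≢i (replicate _ leaf) (corolla b))
                                       (lookup-replicate j leaf)))
                           leaf-match

  graft-no-match : ∀ a (ts : Vec Tr (arity a)) i b → lookup ts i ≡ leaf → ¬ Match (graft a i b) (node a ts)
  graft-no-match a ts i b ts[i]≡leaf (node-match matchChild) =
    corolla∌leaf (subst (Match (corolla b)) ts[i]≡leaf
      (subst (λ s → Match s (lookup ts i)) (lookup∘update i (replicate _ leaf) (corolla b)) (matchChild i)))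
    where
    corolla∌leaf : ¬ Match (corolla b) leaf
    corolla∌leaf ()

  admissible⇒avoids : ∀ {t} → Admissible t → Avoids t
  admissible⇒avoids adm-leaf s (a , b , i , i<ℓ , refl) (here ())
  admissible⇒avoids (adm-node {ts = ts} pre _) s (a , b , i , i<ℓ , refl) (here m@(node-match _)) =
    graft-no-match a ts i b (leafPrefix-lookup ts pre i i<ℓ) m
  admissible⇒avoids (adm-node _ children) s s∈𝒫 (there i f) = admissible⇒avoids (children i) s s∈𝒫 f

  mutual
    avoids⇒admissible : ∀ t → Avoids t → Admissible t
    avoids⇒admissible leaf        _   = adm-leaf
    avoids⇒admissible (node a ts) avo =
      adm-node (leafPrefix-intro ts prefixLeaves)
           (childrenAdmissible ts λ i s s∈𝒫 f → avo s s∈𝒫 (there i f))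
      where
      prefixLeaves : ∀ i → toℕ i < Letter.ℓ a → lookup ts i ≡ leaf
      prefixLeaves i i<ℓ with lookup ts i in ts[i]
      ... | leaf      = refl
      ... | node b us = ⊥-elim (avo (graft a i b) (a , b , i , i<ℓ , refl) (here (graft-match a ts i b us ts[i])))

    childrenAdmissible : ∀ {n} (ts : Vec Tr n) → (∀ i → Avoids (lookup ts i)) → ∀ i → Admissible (lookup ts i)
    childrenAdmissible (x ∷ᵥ ts) h Fin.zero    = avoids⇒admissible x (h Fin.zero)
    childrenAdmissible (x ∷ᵥ ts) h (Fin.suc i) = childrenAdmissible ts (λ j → h (Fin.suc j)) i

  -- Size bounds: every tree has a leaf, so a child of a node of arity ≥ 2
  -- has strictly fewer leaves than the node.
  mutual
    leaves-pos : ∀ t → 1 ≤ leaves t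
    leaves-pos leaf = s≤s z≤n
    leaves-pos (node (letter k ℓ _ 2≤k+ℓ _) ts) = ℕP.≤-trans (ℕP.≤-trans (s≤s z≤n) 2≤k+ℓ) (length≤leavesV ts)

    length≤leavesV : ∀ {n} (v : Vec Tr n) → n ≤ leavesV v
    length≤leavesV []ᵥ       = z≤n
    length≤leavesV (x ∷ᵥ v) = ℕP.+-mono-≤ (leaves-pos x) (length≤leavesV v)

  child-leaves : ∀ {n} (v : Vec Tr (suc n)) i → leaves (lookup v i) ℕ.+ n ≤ leavesV v
  child-leaves (x ∷ᵥ w) Fin.zero = ℕP.+-monoʳ-≤ (leaves x) (length≤leavesV w)
  child-leaves {suc n} (x ∷ᵥ w) (Fin.suc i) =
    subst (_≤ leaves x ℕ.+ leavesV w) (sym (ℕP.+-suc (leaves (lookup w i)) n))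
          (ℕP.+-mono-≤ (leaves-pos x) (child-leaves w i))

  child-smaller : ∀ {n} (v : Vec Tr n) i → 2 ≤ n → leaves (lookup v i) < leavesV v
  child-smaller {suc zero}    v i (s≤s ())
  child-smaller {suc (suc n)} v i _ =
    ℕP.≤-trans (s≤s (ℕP.m≤m+n (leaves (lookup v i)) n))
               (ℕP.≤-trans (ℕP.≤-reflexive (sym (ℕP.+-suc (leaves (lookup v i)) n))) (child-leaves v i))

  leafPrefix≤leaves : ∀ {n} ℓ (v : Vec Tr n) → LeafPrefix ℓ v → ℓ ≤ n → ℓ ≤ leavesV v
  leafPrefix≤leaves zero    v         _              _        = z≤n
  leafPrefix≤leaves (suc ℓ) (x ∷ᵥ v) (refl , pre) (s≤s ℓ≤n) = s≤s (leafPrefix≤leaves ℓ v pre ℓ≤n)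

  -- Given lists T i (meant to enumerate admissible trees
  -- with i leaves), childVecs T n ℓ m lists the vectors of n trees with m
  -- leaves in total whose first ℓ entries are leaves and the others from T.

  ChildVec : (ℕ → List Tr) → ∀ {n} → ℕ → Vec Tr n → Set
  ChildVec T ℓ       []ᵥ       = ⊤
  ChildVec T zero    (x ∷ᵥ v) = x ∈ T (leaves x) × ChildVec T zero v
  ChildVec T (suc ℓ) (x ∷ᵥ v) = x ≡ leaf × ChildVec T ℓ v

  prepend : ∀ {n} → List (Vec Tr n) → Tr → List (Vec Tr (suc n))
  prepend vs x = map (x ∷ᵥ_) vs

  childVecs : (ℕ → List Tr) → (n ℓ m : ℕ) → List (Vec Tr n)
  childVecs T zero    ℓ       zero    = []ᵥ ∷ []
  childVecs T zero    ℓ       (suc m) = []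
  childVecs T (suc n) zero    m       =
    cat≤ m λ i → concatMap (prepend (childVecs T n zero (m ∸ i))) (T i)
  childVecs T (suc n) (suc ℓ) zero    = []
  childVecs T (suc n) (suc ℓ) (suc m) = map (leaf ∷ᵥ_) (childVecs T n ℓ m)

  counts : (ℕ → List Tr) → ℕ → ℕ
  counts T i = length (T i)

  length-childVecs : ∀ T n ℓ m → ℓ ≤ n → ℓ ≤ m →
                     length (childVecs T n ℓ m) ≡ (counts T ^⋆ (n ∸ ℓ)) (m ∸ ℓ)
  length-childVecs T zero    zero    zero    _ _ = refl
  length-childVecs T zero    zero    (suc m) _ _ = refl
  length-childVecs T (suc n) zero    m       _ _ =
    trans (length-cat≤ m _) (Σℕ≤-cong m λ i _ →
      trans (length-concatMap-const (prepend (childVecs T n zero (m ∸ i))) _ (T i)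
                                    (λ {x} _ → length-map (x ∷ᵥ_) (childVecs T n zero (m ∸ i))))
            (cong (counts T i ℕ.*_) (length-childVecs T n zero (m ∸ i) z≤n z≤n)))
  length-childVecs T (suc n) (suc ℓ) (suc m) (s≤s ℓ≤n) (s≤s ℓ≤m) =
    trans (length-map (leaf ∷ᵥ_) (childVecs T n ℓ m)) (length-childVecs T n ℓ m ℓ≤n ℓ≤m)

  childVecs-complete : ∀ T n ℓ (v : Vec Tr n) → ChildVec T ℓ v → v ∈ childVecs T n ℓ (leavesV v)
  childVecs-complete T zero    ℓ       []ᵥ       _ = here refl
  childVecs-complete T (suc n) zero    (x ∷ᵥ v) (x∈ , rest) =
    ∈-cat≤⁺ _ _ (ℕP.m≤m+n (leaves x) (leavesV v))
      (∈-concatMap⁺′ (prepend (childVecs T n zero (leaves x ℕ.+ leavesV v ∸ leaves x))) x∈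
        (∈-map⁺ _ (subst (λ m → v ∈ childVecs T n zero m) (sym (ℕP.m+n∸m≡n (leaves x) (leavesV v)))
                         (childVecs-complete T n zero v rest))))
  childVecs-complete T (suc n) (suc ℓ) (x ∷ᵥ v) (refl , rest) = ∈-map⁺ _ (childVecs-complete T n ℓ v rest)

  module _ (T : ℕ → List Tr) (T-sized : ∀ i {x} → x ∈ T i → leaves x ≡ i) where

    childVecs-sound : ∀ n ℓ m {v} → v ∈ childVecs T n ℓ m → ChildVec T ℓ v × leavesV v ≡ m
    childVecs-sound zero    ℓ       zero    (here refl) = tt , refl
    childVecs-sound (suc n) zero    m       v∈ with ∈-cat≤⁻ m _ v∈
    ... | i , i≤m , v∈block with ∈-concatMap⁻′ (prepend (childVecs T n zero (m ∸ i))) (T i) v∈block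
    ... | x , x∈ , v∈map with ∈-map⁻ _ v∈map
    ... | w , w∈ , refl with childVecs-sound n zero (m ∸ i) w∈
    ... | rest , leaves-w =
      (subst (λ j → x ∈ T j) (sym (T-sized i x∈)) x∈ , rest) ,
      trans (cong₂ ℕ._+_ (T-sized i x∈) leaves-w) (ℕP.m+[n∸m]≡n i≤m)
    childVecs-sound (suc n) (suc ℓ) (suc m) v∈ with ∈-map⁻ _ v∈
    ... | w , w∈ , refl with childVecs-sound n ℓ m w∈
    ... | rest , leaves-w = (refl , rest) , cong suc leaves-w

    childVecs-unique : (∀ i → Unique (T i)) → ∀ n ℓ m → Unique (childVecs T n ℓ m)
    childVecs-unique uT zero    ℓ       zero    = All.[] ∷ []
    childVecs-unique uT zero    ℓ       (suc m) = []
    childVecs-unique uT (suc n) zero    m       =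
      unique-cat≤ m _ (λ v → leaves (Vec.head v)) headSized λ i →
        unique-concatMap (prepend (childVecs T n zero (m ∸ i))) (λ x v → Vec.head v ≡ x) headIs
                         (λ e e′ → trans (sym e) e′)
          (λ x → Unique.map⁺ (cong Vec.tail) (childVecs-unique uT n zero (m ∸ i))) (uT i)
      where
      headIs : ∀ {vs : List (Vec Tr n)} x {v} → v ∈ prepend vs x → Vec.head v ≡ x
      headIs x v∈ with ∈-map⁻ _ v∈
      ... | _ , _ , refl = refl
      headSized : ∀ i {v} → v ∈ concatMap (prepend (childVecs T n zero (m ∸ i))) (T i) →
                  leaves (Vec.head v) ≡ i
      headSized i v∈ with ∈-concatMap⁻′ (prepend (childVecs T n zero (m ∸ i))) (T i) v∈
      ... | x , x∈ , v∈map rewrite headIs x v∈map = T-sized i x∈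
    childVecs-unique uT (suc n) (suc ℓ) zero    = []
    childVecs-unique uT (suc n) (suc ℓ) (suc m) = Unique.map⁺ (cong Vec.tail) (childVecs-unique uT n ℓ m)

  childVec⇒leafPrefix : ∀ {T n} ℓ (v : Vec Tr n) → ChildVec T ℓ v → LeafPrefix ℓ v
  childVec⇒leafPrefix zero    v         _            = tt
  childVec⇒leafPrefix (suc ℓ) []ᵥ       _            = tt
  childVec⇒leafPrefix (suc ℓ) (x ∷ᵥ v) (x≡leaf , cv) = x≡leaf , childVec⇒leafPrefix ℓ v cv

  childVec⇒admissible : ∀ {T n} → (∀ i {x} → x ∈ T i → Admissible x) →
                        ∀ ℓ (v : Vec Tr n) → ChildVec T ℓ v → ∀ i → Admissible (lookup v i)
  childVec⇒admissible adm zero    (x ∷ᵥ v) (x∈ , cv)   Fin.zero    = adm _ x∈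
  childVec⇒admissible adm zero    (x ∷ᵥ v) (x∈ , cv)   (Fin.suc i) = childVec⇒admissible adm zero v cv i
  childVec⇒admissible adm (suc ℓ) (x ∷ᵥ v) (refl , cv) Fin.zero    = adm-leaf
  childVec⇒admissible adm (suc ℓ) (x ∷ᵥ v) (_ , cv)    (Fin.suc i) = childVec⇒admissible adm ℓ v cv i

  childVec-intro : ∀ {T n} ℓ (v : Vec Tr n) → LeafPrefix ℓ v →
                   (∀ i → lookup v i ∈ T (leaves (lookup v i))) → ChildVec T ℓ v
  childVec-intro ℓ       []ᵥ       _              _     = tt
  childVec-intro zero    (x ∷ᵥ v) _              inT = inT Fin.zero , childVec-intro zero v tt (λ i → inT (Fin.suc i))
  childVec-intro (suc ℓ) (x ∷ᵥ v) (x≡leaf , pre) inT = x≡leaf , childVec-intro ℓ v pre (λ i → inT (Fin.suc i))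

  lettersFrom : ∀ k ℓ → Dec (k ≤ d) → Dec (2 ≤ k ℕ.+ ℓ) → List (Letter d P)
  lettersFrom k ℓ (yes k≤d) (yes 2≤) = map (letter k ℓ k≤d 2≤) (allFin (coeff (P k) ℓ))
  lettersFrom k ℓ _         _        = []

  lettersOf : ℕ → ℕ → List (Letter d P)
  lettersOf k ℓ = lettersFrom k ℓ (k ≤? d) (2 ≤? k ℕ.+ ℓ)

  ∈-lettersFrom⁻ : ∀ {k ℓ} dk dq {a} → a ∈ lettersFrom k ℓ dk dq → Letter.k a ≡ k × Letter.ℓ a ≡ ℓ
  ∈-lettersFrom⁻ (yes _) (yes _) a∈ with ∈-map⁻ _ a∈
  ... | _ , _ , refl = refl , refl

  ∈-lettersOf⁻ : ∀ {k ℓ a} → a ∈ lettersOf k ℓ → Letter.k a ≡ k × Letter.ℓ a ≡ ℓ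
  ∈-lettersOf⁻ {k} {ℓ} = ∈-lettersFrom⁻ (k ≤? d) (2 ≤? k ℕ.+ ℓ)

  ∈-lettersFrom⁺ : ∀ {k ℓ} k≤d 2≤ m dk dq → letter k ℓ k≤d 2≤ m ∈ lettersFrom k ℓ dk dq
  ∈-lettersFrom⁺ k≤d 2≤ m (yes k≤d′) (yes 2≤′)
    rewrite ℕP.≤-irrelevant k≤d k≤d′ | ℕP.≤-irrelevant 2≤ 2≤′ = ∈-map⁺ _ (∈-allFin m)
  ∈-lettersFrom⁺ k≤d 2≤ m (yes _)    (no ¬2≤) = ⊥-elim (¬2≤ 2≤)
  ∈-lettersFrom⁺ k≤d 2≤ m (no ¬k≤d)  _        = ⊥-elim (¬k≤d k≤d)

  unique-lettersOf : ∀ k ℓ → Unique (lettersOf k ℓ)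
  unique-lettersOf k ℓ with k ≤? d | 2 ≤? k ℕ.+ ℓ
  ... | yes _ | yes _ = Unique.map⁺ (λ { refl → refl }) (Unique.allFin⁺ _)
  ... | yes _ | no _  = []
  ... | no _  | _     = []

  nodesWith : (ℕ → List Tr) → ℕ → Letter d P → List Tr
  nodesWith T j a = map (node a) (childVecs T (arity a) (Letter.ℓ a) j)

  block : (ℕ → List Tr) → ℕ → ℕ → ℕ → List Tr
  block T j k ℓ = concatMap (nodesWith T j) (lettersOf k ℓ)

  nodes : (ℕ → List Tr) → ℕ → List Tr
  nodes T j = cat≤ d λ k → cat≤ j λ ℓ → block T j k ℓ

  leafList : ℕ → List Tr
  leafList (suc zero) = leaf ∷ []
  leafList _          = []

  -- avoiders s j lists the admissible trees with j leaves, provided j ≤ s.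
  avoiders : ℕ → ℕ → List Tr
  avoiders zero    j = []
  avoiders (suc s) j = leafList j ++ nodes (avoiders s) j

  ∈-leafList⁻ : ∀ j {t} → t ∈ leafList j → t ≡ leaf × j ≡ 1
  ∈-leafList⁻ (suc zero) (here refl) = refl , refl

  unique-leafList : ∀ j → Unique (leafList j)
  unique-leafList zero          = []
  unique-leafList (suc zero)    = All.[] ∷ []
  unique-leafList (suc (suc _)) = []

  RootedAt : (ℕ → List Tr) → ℕ → ℕ → ℕ → Tr → Set
  RootedAt T j k ℓ t = Σ (Letter d P) λ a → Σ (Vec Tr (arity a)) λ v →
    Letter.k a ≡ k × Letter.ℓ a ≡ ℓ × t ≡ node a v × v ∈ childVecs T (arity a) (Letter.ℓ a) j

  ∈-block⁻ : ∀ T j k ℓ {t} → t ∈ block T j k ℓ → RootedAt T j k ℓ t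
  ∈-block⁻ T j k ℓ t∈ with ∈-concatMap⁻′ (nodesWith T j) (lettersOf k ℓ) t∈
  ... | a , a∈ , t∈nodes with ∈-map⁻ (node a) t∈nodes
  ... | v , v∈ , refl = let ek , eℓ = ∈-lettersOf⁻ a∈ in a , v , ek , eℓ , refl , v∈

  ∈-nodes⁻ : ∀ T j {t} → t ∈ nodes T j → ∃ λ k → ∃ λ ℓ → RootedAt T j k ℓ t
  ∈-nodes⁻ T j t∈ with ∈-cat≤⁻ d _ t∈
  ... | k , _ , t∈k with ∈-cat≤⁻ j _ t∈k
  ... | ℓ , _ , t∈kℓ = k , ℓ , ∈-block⁻ T j k ℓ t∈kℓ

  rootK rootL : Tr → ℕ
  rootK leaf       = 0
  rootK (node a _) = Letter.k a
  rootL leaf       = 0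
  rootL (node a _) = Letter.ℓ a

  HasRoot : Letter d P → Tr → Set
  HasRoot a t = Σ (Vec Tr (arity a)) λ v → t ≡ node a v

  nodes-unique : ∀ T → (∀ i {x} → x ∈ T i → leaves x ≡ i) → (∀ i → Unique (T i)) →
                 ∀ j → Unique (nodes T j)
  nodes-unique T T-sized uT j =
    unique-cat≤ d _ rootK rootK-block λ k →
      unique-cat≤ j _ rootL (rootL-block k) λ ℓ →
        unique-concatMap (nodesWith T j) HasRoot hasRoot (λ { (_ , refl) (_ , refl) → refl })
          (λ a → Unique.map⁺ (λ { refl → refl }) (childVecs-unique T T-sized uT (arity a) (Letter.ℓ a) j))
          (unique-lettersOf k ℓ)
    where
    hasRoot : ∀ a {t} → t ∈ nodesWith T j a → HasRoot a t
    hasRoot a t∈ with ∈-map⁻ (node a) t∈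
    ... | v , _ , t≡ = v , t≡
    rootL-block : ∀ k ℓ {t} → t ∈ block T j k ℓ → rootL t ≡ ℓ
    rootL-block k ℓ t∈ with ∈-block⁻ T j k ℓ t∈
    ... | _ , _ , _ , eℓ , refl , _ = eℓ
    rootK-block : ∀ k {t} → t ∈ cat≤ j (block T j k) → rootK t ≡ k
    rootK-block k t∈ with ∈-cat≤⁻ j _ t∈
    ... | ℓ , _ , t∈kℓ with ∈-block⁻ T j k ℓ t∈kℓ
    ... | _ , _ , ek , _ , refl , _ = ek

  avoiders-sound : ∀ s j {t} → t ∈ avoiders s j → leaves t ≡ j × Admissible t
  avoiders-sound (suc s) j t∈ with ∈-++⁻ (leafList j) t∈
  ... | inj₁ t∈leaf with ∈-leafList⁻ j t∈leaf
  ...   | refl , refl = refl , adm-leaf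
  avoiders-sound (suc s) j t∈ | inj₂ t∈nodes with ∈-nodes⁻ (avoiders s) j t∈nodes
  ... | _ , ℓ , a , v , _ , refl , refl , v∈
    with childVecs-sound (avoiders s) (λ i x∈ → proj₁ (avoiders-sound s i x∈)) _ _ j v∈
  ... | cv , leaves-v =
    leaves-v , adm-node (childVec⇒leafPrefix _ v cv)
                        (childVec⇒admissible (λ i x∈ → proj₂ (avoiders-sound s i x∈)) _ v cv)

  avoiders-unique : ∀ s j → Unique (avoiders s j)
  avoiders-unique zero    j = []
  avoiders-unique (suc s) j =
    Unique.++⁺ (unique-leafList j)
               (nodes-unique (avoiders s) (λ i x∈ → proj₁ (avoiders-sound s i x∈)) (avoiders-unique s) j)
               leaf∉nodes
    where
    leaf∉nodes : ∀ {t} → t ∈ leafList j × t ∈ nodes (avoiders s) j → ⊥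
    leaf∉nodes (t∈leaf , t∈nodes) with ∈-leafList⁻ j t∈leaf | ∈-nodes⁻ (avoiders s) j t∈nodes
    ... | refl , _ | _ , _ , _ , _ , _ , _ , () , _

  avoiders-complete : ∀ s t → Admissible t → leaves t ≤ s → t ∈ avoiders s (leaves t)
  avoiders-complete zero t _ t≤0 with ℕP.≤-trans (leaves-pos t) t≤0
  ... | ()
  avoiders-complete (suc s) leaf _ _ = here refl
  avoiders-complete (suc s) (node a@(letter k ℓ k≤d 2≤ m) v) (adm-node pre children) size =
    ∈-++⁺ʳ (leafList (leavesV v))
      (∈-cat≤⁺ d _ k≤d (∈-cat≤⁺ (leavesV v) _ (leafPrefix≤leaves ℓ v pre (ℕP.m≤n+m ℓ k))
        (∈-concatMap⁺′ (nodesWith (avoiders s) (leavesV v)) (∈-lettersFrom⁺ k≤d 2≤ m (k ≤? d) (2 ≤? k ℕ.+ ℓ))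
          (∈-map⁺ (node a) (childVecs-complete (avoiders s) (k ℕ.+ ℓ) ℓ v
            (childVec-intro ℓ v pre λ i → avoiders-complete s (lookup v i) (children i) (childFits i)))))))
    where
    childFits : ∀ i → leaves (lookup v i) ≤ s
    childFits i = ℕP.≤-pred (ℕP.≤-trans (child-smaller v i 2≤) size)

  avoiders-enumerates : ∀ s j → j ≤ s → Enumerates d P j (avoiders s j)
  avoiders-enumerates s j j≤s = avoiders-unique s j , λ t → mk⇔
    (λ t∈ → let leaves-t , adm = avoiders-sound s j t∈ in leaves-t , admissible⇒avoids adm)
    (λ { (refl , avo) → avoiders-complete s t (avoids⇒admissible t avo) j≤s })

  count-stable : ∀ s s′ i → i ≤ s → i ≤ s′ → length (avoiders s i) ≡ length (avoiders s′ i)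
  count-stable s s′ i i≤s i≤s′ =
    unique-same-length (avoiders-unique s i) (avoiders-unique s′ i) λ {t} →
      mk⇔ (move s s′ i≤s′) (move s′ s i≤s)
    where
    move : ∀ s₁ s₂ {t} → i ≤ s₂ → t ∈ avoiders s₁ i → t ∈ avoiders s₂ i
    move s₁ s₂ i≤s₂ t∈ with avoiders-sound s₁ i t∈
    ... | refl , adm = avoiders-complete s₂ _ adm i≤s₂

  letterCount : ℕ → ℕ → ℕ
  letterCount k ℓ = length (lettersOf k ℓ)

  length-block : ∀ T j k ℓ → ℓ ≤ j → length (block T j k ℓ) ≡ letterCount k ℓ ℕ.* (counts T ^⋆ k) (j ∸ ℓ)
  length-block T j k ℓ ℓ≤j =
    trans (length-concatMap-const (nodesWith T j) _ (lettersOf k ℓ) sameShape)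
          (cong (letterCount k ℓ ℕ.*_)
                (trans (length-childVecs T (k ℕ.+ ℓ) ℓ j (ℕP.m≤n+m ℓ k) ℓ≤j)
                       (cong (λ n → (counts T ^⋆ n) (j ∸ ℓ)) (ℕP.m+n∸n≡m k ℓ))))
    where
    sameShape : ∀ {a} → a ∈ lettersOf k ℓ → length (nodesWith T j a) ≡ length (childVecs T (k ℕ.+ ℓ) ℓ j)
    sameShape {a} a∈ with ∈-lettersOf⁻ {k} {ℓ} a∈
    ... | ek , eℓ = trans (length-map (node a) (childVecs T (arity a) (Letter.ℓ a) j))
                          (cong₂ (λ x y → length (childVecs T (x ℕ.+ y) y j)) ek eℓ)

  length-avoiders : ∀ s j → length (avoiders (suc s) j) ≡
    length (leafList j) ℕ.+ Σℕ≤ d (λ k → Σℕ≤ j λ ℓ → letterCount k ℓ ℕ.* (counts (avoiders s) ^⋆ k) (j ∸ ℓ))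
  length-avoiders s j =
    trans (length-++ (leafList j)) (cong (length (leafList j) ℕ.+_)
      (trans (length-cat≤ d _) (Σℕ≤-cong d λ k _ →
        trans (length-cat≤ j _) (Σℕ≤-cong j λ ℓ ℓ≤j → length-block (avoiders s) j k ℓ ℓ≤j))))

  -- The exceptional coefficient ⟨t^1,P_0⟩, realised by the leaf rather than by a letter.
  leafWeight : ℕ → ℕ → ℕ
  leafWeight zero (suc zero) = 1
  leafWeight _    _          = 0

  leafWeight-sum : ∀ (c : ℕ → ℕ) j →
    Σℕ≤ d (λ k → Σℕ≤ j λ ℓ → leafWeight k ℓ ℕ.* (c ^⋆ k) (j ∸ ℓ)) ≡ length (leafList j)
  leafWeight-sum c j =
    trans (Σℕ≤-single d 0 _ z≤n λ { zero k≢0 → ⊥-elim (k≢0 refl) ; (suc k) _ → Σℕ≤-vanish j _ (λ _ _ → refl) })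
          (leafTerm j)
    where
    leafTerm : ∀ j → Σℕ≤ j (λ ℓ → leafWeight 0 ℓ ℕ.* δ₀ (j ∸ ℓ)) ≡ length (leafList j)
    leafTerm zero          = refl
    leafTerm (suc zero)    = refl
    leafTerm (suc (suc j)) =
      Σℕ≤-single (suc (suc j)) 1 _ (s≤s z≤n)
        λ { zero _ → refl ; (suc zero) ℓ≢1 → ⊥-elim (ℓ≢1 refl) ; (suc (suc ℓ)) _ → refl }

  leafWeight-vanish : ∀ k ℓ → 2 ≤ k ℕ.+ ℓ → leafWeight k ℓ ≡ 0
  leafWeight-vanish zero    (suc zero)    (s≤s ())
  leafWeight-vanish zero    zero          _ = refl
  leafWeight-vanish zero    (suc (suc ℓ)) _ = refl
  leafWeight-vanish (suc k) ℓ             _ = refl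

  module _ (P₁0≡0 : coeff (P 1) 0 ≡ 0) (P₀0≡0 : coeff (P 0) 0 ≡ 0) (P₀1≡1 : coeff (P 0) 1 ≡ 1) where

    coeff-split′ : ∀ k ℓ dk dq → k ≤ d → coeff (P k) ℓ ≡ length (lettersFrom k ℓ dk dq) ℕ.+ leafWeight k ℓ
    coeff-split′ k ℓ (no k≰d) _ k≤d = ⊥-elim (k≰d k≤d)
    coeff-split′ k ℓ (yes k≤d) (yes 2≤) _ = begin
      c                              ≡⟨ sym (length-tabulate (λ m → m)) ⟩
      length (allFin c)              ≡⟨ sym (length-map L (allFin c)) ⟩
      length (map L (allFin c))      ≡⟨ sym (ℕP.+-identityʳ _) ⟩
      length (map L (allFin c)) ℕ.+ 0 ≡⟨ cong (length (map L (allFin c)) ℕ.+_) (sym (leafWeight-vanish k ℓ 2≤)) ⟩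
      length (map L (allFin c)) ℕ.+ leafWeight k ℓ ∎
      where
      open ≡-Reasoning
      c : ℕ
      c = coeff (P k) ℓ
      L : Fin c → Letter d P
      L = letter k ℓ k≤d 2≤
    coeff-split′ zero          zero          (yes _) (no _)   _ = P₀0≡0
    coeff-split′ zero          (suc zero)    (yes _) (no _)   _ = P₀1≡1
    coeff-split′ (suc zero)    zero          (yes _) (no _)   _ = P₁0≡0
    coeff-split′ zero          (suc (suc ℓ)) (yes _) (no ¬2≤) _ = ⊥-elim (¬2≤ (s≤s (s≤s z≤n)))
    coeff-split′ (suc zero)    (suc ℓ)       (yes _) (no ¬2≤) _ = ⊥-elim (¬2≤ (s≤s (s≤s z≤n)))
    coeff-split′ (suc (suc k)) ℓ             (yes _) (no ¬2≤) _ = ⊥-elim (¬2≤ (s≤s (s≤s z≤n)))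

    coeff-split : ∀ k ℓ → k ≤ d → coeff (P k) ℓ ≡ letterCount k ℓ ℕ.+ leafWeight k ℓ
    coeff-split k ℓ = coeff-split′ k ℓ (k ≤? d) (2 ≤? k ℕ.+ ℓ)

    avoidCount : ℕ → ℕ
    avoidCount j = length (avoiders (suc j) j)

    recurrence : ∀ j → avoidCount j ≡ Σℕ≤ d (λ k → Σℕ≤ j λ ℓ → coeff (P k) ℓ ℕ.* (avoidCount ^⋆ k) (j ∸ ℓ))
    recurrence j = begin
      avoidCount j
        ≡⟨ length-avoiders j j ⟩
      length (leafList j) ℕ.+ ΣΣ approxTerm
        ≡⟨ cong₂ ℕ._+_ (sym (leafWeight-sum avoidCount j)) (ΣΣ-cong approxTerm letterTerm approx≡letter) ⟩
      ΣΣ leafTerm ℕ.+ ΣΣ letterTerm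
        ≡⟨ ℕP.+-comm (ΣΣ leafTerm) (ΣΣ letterTerm) ⟩
      ΣΣ letterTerm ℕ.+ ΣΣ leafTerm
        ≡⟨ sym (ΣΣ-+ letterTerm leafTerm) ⟩
      ΣΣ (λ k ℓ → letterTerm k ℓ ℕ.+ leafTerm k ℓ)
        ≡⟨ ΣΣ-cong _ coeffTerm split ⟩
      ΣΣ coeffTerm ∎
      where
      open ≡-Reasoning
      ΣΣ : (ℕ → ℕ → ℕ) → ℕ
      ΣΣ f = Σℕ≤ d (λ k → Σℕ≤ j (f k))
      ΣΣ-cong : ∀ f g → (∀ k ℓ → k ≤ d → ℓ ≤ j → f k ℓ ≡ g k ℓ) → ΣΣ f ≡ ΣΣ g
      ΣΣ-cong f g e = Σℕ≤-cong d λ k k≤d → Σℕ≤-cong j (λ ℓ → e k ℓ k≤d)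
      ΣΣ-+ : ∀ f g → ΣΣ (λ k ℓ → f k ℓ ℕ.+ g k ℓ) ≡ ΣΣ f ℕ.+ ΣΣ g
      ΣΣ-+ f g = trans (Σℕ≤-cong d λ k _ → Σℕ≤-+ j (f k) (g k)) (Σℕ≤-+ d (λ k → Σℕ≤ j (f k)) (λ k → Σℕ≤ j (g k)))

      approxTerm letterTerm leafTerm coeffTerm : ℕ → ℕ → ℕ
      approxTerm k ℓ = letterCount k ℓ ℕ.* (counts (avoiders j) ^⋆ k) (j ∸ ℓ)
      letterTerm k ℓ = letterCount k ℓ ℕ.* (avoidCount ^⋆ k) (j ∸ ℓ)
      leafTerm   k ℓ = leafWeight k ℓ ℕ.* (avoidCount ^⋆ k) (j ∸ ℓ)
      coeffTerm  k ℓ = coeff (P k) ℓ ℕ.* (avoidCount ^⋆ k) (j ∸ ℓ)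

      -- Budget j already counts every tree with at most j leaves.
      stable : ∀ i → i ≤ j → counts (avoiders j) i ≡ avoidCount i
      stable i i≤j = count-stable j (suc i) i i≤j (ℕP.n≤1+n i)

      approx≡letter : ∀ k ℓ → k ≤ d → ℓ ≤ j → approxTerm k ℓ ≡ letterTerm k ℓ
      approx≡letter k ℓ _ _ = cong (letterCount k ℓ ℕ.*_) (^⋆-local j stable k (j ∸ ℓ) (ℕP.m∸n≤m j ℓ))

      split : ∀ k ℓ → k ≤ d → ℓ ≤ j → letterTerm k ℓ ℕ.+ leafTerm k ℓ ≡ coeffTerm k ℓ
      split k ℓ k≤d _ = trans (sym (ℕP.*-distribʳ-+ ((avoidCount ^⋆ k) (j ∸ ℓ)) (letterCount k ℓ) (leafWeight k ℓ)))
                              (cong (ℕ._* (avoidCount ^⋆ k) (j ∸ ℓ)) (sym (coeff-split k ℓ k≤d)))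

proposition2p3p6 : (d : ℕ) (P : ℕ → List ℕ) →
    Σ Series (λ f → SatisfiesEq d P f) →
    coeff (P 1) 0 ≡ 0 → coeff (P 0) 0 ≡ 0 → coeff (P 0) 1 ≡ 1 →
    Σ (ℕ → List (Tree d P)) λ F →
    (∀ j → Enumerates d P j (F j)) ×
    SatisfiesEq d P (λ j → toℚ (length (F j)))
proposition2p3p6 d P _ P₁0≡0 P₀0≡0 P₀1≡1 =
  (λ j → avoiders (suc j) j) ,
  (λ j → avoiders-enumerates (suc j) j (ℕP.n≤1+n j)) ,
  satisfiesEq-toℚ d P _ (recurrence P₁0≡0 P₀0≡0 P₀1≡1)
  where open Trees d P
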